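{- Let $m\ge2$ be an integer and let $t$ be an integer such that $3$ divides $t-1$ but $9$ does not divide $t-1$. Then there exists $n\in\mathbb{N}$ such that $2^{2^n}\equiv t\pmod{3^m}$. Moreover, such $n$ can be chosen with $n\le 2\cdot3^{m-2}$. -}

{-# OPTIONS --safe #-}

-- 2 is a primitive root modulo every 3^k, and 4 = 2^2 generates the residues ≡ 1 (mod 3). Both
-- follow from one lifting step: if g^N ≡ 1 + 3^K (mod 3^(K+1)) and g^e ≡ x (mod 3^K) with
-- 3 ∤ x, then g^(e + N r) ≡ x (mod 3^(K+1)) for a suitable r < 3, since (1 + 3^K)^r ≡ 1 + r 3^K.
-- Write t ≡ 4^j (mod 3^m). As 4^j ≡ 1 + 3j (mod 9) and t ≢ 1 (mod 9), 3 ∤ j, so j ≡ 2^e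
-- (mod 3^(m-1)) with e < 2·3^(m-2); since 4^(3^(m-1)) ≡ 1 (mod 3^m),
-- 2^(2^(e+1)) = 4^(2^e) ≡ 4^j ≡ t (mod 3^m).

module Submission where

module IntegerCongruence where

  open import Data.Integer using (ℤ; +_; 0ℤ; 1ℤ; _+_; _-_; _*_; _^_; -_)
  open import Data.Integer.DivMod using (_%ℕ_; _/ℕ_; n%ℕd<d; a≡a%ℕn+[a/ℕn]*n)
  open import Data.Integer.Divisibility.Signed using (_∣_; divides)
  open import Data.Integer.Tactic.RingSolver using (solve)
  open import Data.List using (_∷_; [])
  open import Data.Nat using (zero; suc; _<_; NonZero)
  open import Data.Product using (∃-syntax; _×_; _,_)
  open import Level using (0ℓ)
  open import Relation.Binary.Bundles using (Setoid)
  open import Relation.Binary.PropositionalEquality using (_≡_; refl; cong; module ≡-Reasoning)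
  import Relation.Binary.Reasoning.Setoid as SetoidReasoning

  infix 4 _≡_[mod_]

  record _≡_[mod_] (x y n : ℤ) : Set where
    constructor congruent
    field
      quotient : ℤ
      equality : x ≡ y + quotient * n

  variable
    n x x′ y y′ z : ℤ

  ≡-mod-refl : x ≡ x [mod n ]
  ≡-mod-refl {x} {n} = congruent 0ℤ (solve (x ∷ n ∷ []))

  ≡-mod-reflexive : x ≡ y → x ≡ y [mod n ]
  ≡-mod-reflexive refl = ≡-mod-refl

  ≡-mod-sym : x ≡ y [mod n ] → y ≡ x [mod n ]
  ≡-mod-sym {x} {y} {n} (congruent q x≡y+qn) = congruent (- q) (begin
    y                   ≡⟨ solve (y ∷ q ∷ n ∷ []) ⟩
    y + q * n + - q * n ≡⟨ cong (_+ - q * n) x≡y+qn ⟨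
    x + - q * n         ∎)
    where open ≡-Reasoning

  ≡-mod-trans : x ≡ y [mod n ] → y ≡ z [mod n ] → x ≡ z [mod n ]
  ≡-mod-trans {n = n} {z = z} (congruent q refl) (congruent r refl) =
    congruent (q + r) (solve (z ∷ r ∷ q ∷ n ∷ []))

  ≡-mod-setoid : ℤ → Setoid 0ℓ 0ℓ
  ≡-mod-setoid n = record
    { Carrier       = ℤ
    ; _≈_           = _≡_[mod n ]
    ; isEquivalence = record { refl = ≡-mod-refl ; sym = ≡-mod-sym ; trans = ≡-mod-trans }
    }

  module ≡-mod-Reasoning (n : ℤ) = SetoidReasoning (≡-mod-setoid n)

  ≡-mod-+-congˡ : ∀ z → x ≡ y [mod n ] → z + x ≡ z + y [mod n ]
  ≡-mod-+-congˡ {y = y} {n} z (congruent q refl) = congruent q (solve (z ∷ y ∷ q ∷ n ∷ []))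

  ≡-mod-+-congʳ : ∀ z → x ≡ y [mod n ] → x + z ≡ y + z [mod n ]
  ≡-mod-+-congʳ {y = y} {n} z (congruent q refl) = congruent q (solve (z ∷ y ∷ q ∷ n ∷ []))

  ≡-mod-*-cong : x ≡ x′ [mod n ] → y ≡ y′ [mod n ] → x * y ≡ x′ * y′ [mod n ]
  ≡-mod-*-cong {x′ = x′} {n} {y′ = y′} (congruent q refl) (congruent r refl) =
    congruent (q * y′ + x′ * r + q * r * n) (solve (x′ ∷ y′ ∷ q ∷ r ∷ n ∷ []))

  ≡-mod-*-congˡ : ∀ z → x ≡ y [mod n ] → z * x ≡ z * y [mod n ]
  ≡-mod-*-congˡ z = ≡-mod-*-cong (≡-mod-refl {x = z})

  ≡-mod-*-congʳ : ∀ z → x ≡ y [mod n ] → x * z ≡ y * z [mod n ]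
  ≡-mod-*-congʳ z x≡y = ≡-mod-*-cong x≡y (≡-mod-refl {x = z})

  ≡-mod-^-cong : x ≡ y [mod n ] → ∀ k → x ^ k ≡ y ^ k [mod n ]
  ≡-mod-^-cong x≡y zero    = ≡-mod-refl
  ≡-mod-^-cong x≡y (suc k) = ≡-mod-*-cong x≡y (≡-mod-^-cong x≡y k)

  ≡-mod-weaken : ∀ {m} → n ∣ m → x ≡ y [mod m ] → x ≡ y [mod n ]
  ≡-mod-weaken {n} {y = y} (divides d refl) (congruent q refl) =
    congruent (q * d) (solve (y ∷ q ∷ d ∷ n ∷ []))

  ≡-mod-residue : ∀ x m .{{_ : NonZero m}} → ∃[ σ ] σ < m × x ≡ + σ [mod + m ]
  ≡-mod-residue x m = x %ℕ m , n%ℕd<d x m , congruent (x /ℕ m) (a≡a%ℕn+[a/ℕn]*n x m)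

  ≡-mod⇒∣ : x ≡ y [mod n ] → n ∣ x - y
  ≡-mod⇒∣ {y = y} {n} (congruent q refl) = divides q (solve (y ∷ q ∷ n ∷ []))

  ∣⇒≡-mod : n ∣ x - y → x ≡ y [mod n ]
  ∣⇒≡-mod {n} {x} {y} (divides q x-y≡qn) = congruent q (begin
    x           ≡⟨ solve (x ∷ y ∷ []) ⟩
    y + (x - y) ≡⟨ cong (_+_ y) x-y≡qn ⟩
    y + q * n   ∎)
    where open ≡-Reasoning

module PowersModPowersOfThree where

  open IntegerCongruence
  open import Data.Empty using (⊥-elim)
  open import Data.Integer using (ℤ; +_; -[1+_]; 0ℤ; 1ℤ; _+_; _*_; _^_; -_; ∣_∣)
  open import Data.Integer.Divisibility.Signed using (_∣_; divides)
  open import Data.Integer.Properties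
    using ( +-identityˡ; *-identityˡ; *-identityʳ; *-assoc; *-comm; abs-*; pos-*; +-injective
          ; ^-distribˡ-+-*; ^-*-assoc; ^-zeroˡ)
  open import Data.Integer.Tactic.RingSolver using (solve)
  open import Data.List using (_∷_; [])
  import Data.Nat as ℕ
  open import Data.Nat using (zero; suc; _<_; _≤_; z≤n; s≤s)
  import Data.Nat.Properties as ℕₚ
  open import Data.Product using (∃-syntax; _×_; _,_)
  open import Data.Sum using (_⊎_; inj₁; inj₂)
  open import Relation.Binary.PropositionalEquality
    using (_≡_; _≢_; refl; sym; trans; cong; subst; subst₂; module ≡-Reasoning)
  open import Relation.Nullary using (¬_)

  pos-^ : ∀ m n → + (m ℕ.^ n) ≡ (+ m) ^ n
  pos-^ m zero    = refl
  pos-^ m (suc n) = trans (pos-* m (m ℕ.^ n)) (cong (_*_ (+ m)) (pos-^ m n))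

  ^-+-* : ∀ g e N r → g ^ (e ℕ.+ N ℕ.* r) ≡ g ^ e * (g ^ N) ^ r
  ^-+-* g e N r = trans (^-distribˡ-+-* g e (N ℕ.* r)) (cong (g ^ e *_) (sym (^-*-assoc g N r)))

  +-*-< : ∀ {e N r b} → e < N → r < b → e ℕ.+ N ℕ.* r < N ℕ.* b
  +-*-< {e} {N} {r} {b} e<N r<b = begin-strict
    e ℕ.+ N ℕ.* r <⟨ ℕₚ.+-monoˡ-< (N ℕ.* r) e<N ⟩
    N ℕ.+ N ℕ.* r ≡⟨ ℕₚ.*-suc N r ⟨
    N ℕ.* suc r   ≤⟨ ℕₚ.*-monoʳ-≤ N r<b ⟩
    N ℕ.* b       ∎
    where open ℕₚ.≤-Reasoning

  1≢0-mod-3 : ¬ 1ℤ ≡ 0ℤ [mod + 3 ]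
  1≢0-mod-3 (congruent q 1≡3q) =
    1≢n*3 ∣ q ∣ (trans (cong ∣_∣ (trans 1≡3q (+-identityˡ (q * + 3)))) (abs-* q (+ 3)))
    where
    1≢n*3 : ∀ n → 1 ≢ n ℕ.* 3
    1≢n*3 zero    ()
    1≢n*3 (suc n) ()

  ≡1⇒≢0-mod-3 : ∀ {x} → x ≡ 1ℤ [mod + 3 ] → ¬ x ≡ 0ℤ [mod + 3 ]
  ≡1⇒≢0-mod-3 x≡1 x≡0 = 1≢0-mod-3 (≡-mod-trans (≡-mod-sym x≡1) x≡0)

  nonzero-residues-mod-3 : ∀ {x} → ¬ x ≡ 0ℤ [mod + 3 ] →
                           x ≡ 1ℤ [mod + 3 ] ⊎ x ≡ + 2 [mod + 3 ]
  nonzero-residues-mod-3 {x} x≢0 with ≡-mod-residue x 3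
  ... | 0 , _ , x≡0 = ⊥-elim (x≢0 x≡0)
  ... | 1 , _ , x≡1 = inj₁ x≡1
  ... | 2 , _ , x≡2 = inj₂ x≡2
  ... | suc (suc (suc _)) , s≤s (s≤s (s≤s ())) , _

  unit²≡1-mod-3 : ∀ {x} → ¬ x ≡ 0ℤ [mod + 3 ] → x * x ≡ 1ℤ [mod + 3 ]
  unit²≡1-mod-3 x≢0 with nonzero-residues-mod-3 x≢0
  ... | inj₁ x≡1 = ≡-mod-*-cong x≡1 x≡1
  ... | inj₂ x≡2 = ≡-mod-trans (≡-mod-*-cong x≡2 x≡2) (congruent 1ℤ refl)

  -- r is the residue of -c x, because x² ≡ 1.
  c+rx≡0-mod-3-solvable : ∀ {x} → ¬ x ≡ 0ℤ [mod + 3 ] → ∀ c →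
                          ∃[ r ] r < 3 × c + + r * x ≡ 0ℤ [mod + 3 ]
  c+rx≡0-mod-3-solvable {x} x≢0 c with ≡-mod-residue (- (c * x)) 3
  ... | r , r<3 , -cx≡r = r , r<3 , (begin
    c + + r * x             ≈⟨ ≡-mod-+-congʳ (+ r * x) cx²≡c ⟨
    c * (x * x) + + r * x   ≡⟨ regroup (+ r) ⟩
    (c * x + + r) * x       ≈⟨ ≡-mod-*-congʳ x (≡-mod-+-congˡ (c * x) -cx≡r) ⟨
    (c * x + - (c * x)) * x ≡⟨ solve (c ∷ x ∷ []) ⟩
    0ℤ                      ∎)
    where
    open ≡-mod-Reasoning (+ 3)
    regroup : ∀ ρ → c * (x * x) + ρ * x ≡ (c * x + ρ) * x
    regroup ρ = solve (c ∷ x ∷ ρ ∷ [])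
    cx²≡c : c * (x * x) ≡ c [mod + 3 ]
    cx²≡c = ≡-mod-trans (≡-mod-*-congˡ c (unit²≡1-mod-3 x≢0)) (≡-mod-reflexive (*-identityʳ c))

  [1+a][1+Ra]≡1+[1+R]a : ∀ {n a} → a * a ≡ 0ℤ [mod n ] → ∀ R →
                         (1ℤ + a) * (1ℤ + R * a) ≡ 1ℤ + (1ℤ + R) * a [mod n ]
  [1+a][1+Ra]≡1+[1+R]a {n} {a} (congruent h a²≡hn) R = congruent (R * h) (begin
    (1ℤ + a) * (1ℤ + R * a)              ≡⟨ solve (a ∷ R ∷ []) ⟩
    1ℤ + (1ℤ + R) * a + R * (a * a)      ≡⟨ cong (λ s → 1ℤ + (1ℤ + R) * a + R * s) a²≡hn ⟩
    1ℤ + (1ℤ + R) * a + R * (0ℤ + h * n) ≡⟨ solve (a ∷ R ∷ h ∷ n ∷ []) ⟩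
    1ℤ + (1ℤ + R) * a + R * h * n        ∎)
    where open ≡-Reasoning

  [1+a]^r≡1+ra : ∀ {n a} → a * a ≡ 0ℤ [mod n ] → ∀ r → (1ℤ + a) ^ r ≡ 1ℤ + + r * a [mod n ]
  [1+a]^r≡1+ra {a = a} a²≡0 zero    = ≡-mod-reflexive (solve (a ∷ []))
  [1+a]^r≡1+ra {a = a} a²≡0 (suc r) =
    ≡-mod-trans (≡-mod-*-congˡ (1ℤ + a) ([1+a]^r≡1+ra {a = a} a²≡0 r))
                ([1+a][1+Ra]≡1+[1+R]a {a = a} a²≡0 (+ r))

  [3p]²≡0-mod-9p : ∀ p → (+ 3 * p) * (+ 3 * p) ≡ 0ℤ [mod + 3 * (+ 3 * p) ]
  [3p]²≡0-mod-9p p = congruent p (solve (p ∷ []))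

  [x+qa][1+Ra]≡x-mod-3a : ∀ {p x q R} → q + R * x ≡ 0ℤ [mod + 3 ] → let a = + 3 * p in
                          (x + q * a) * (1ℤ + R * a) ≡ x [mod + 3 * a ]
  [x+qa][1+Ra]≡x-mod-3a {p} {x} {q} {R} (congruent s q+Rx≡3s) = congruent (s + R * q * p) (begin
    (x + q * (+ 3 * p)) * (1ℤ + R * (+ 3 * p))
      ≡⟨ solve (p ∷ x ∷ q ∷ R ∷ []) ⟩
    x + (q + R * x) * (+ 3 * p) + R * q * p * (+ 3 * (+ 3 * p))
      ≡⟨ cong (λ u → x + u * (+ 3 * p) + R * q * p * (+ 3 * (+ 3 * p))) q+Rx≡3s ⟩
    x + (0ℤ + s * + 3) * (+ 3 * p) + R * q * p * (+ 3 * (+ 3 * p))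
      ≡⟨ solve (p ∷ x ∷ q ∷ R ∷ s ∷ []) ⟩
    x + (s + R * q * p) * (+ 3 * (+ 3 * p))
      ∎)
    where open ≡-Reasoning

  lift-^-solution : ∀ {g x} K N {e} → g ^ N ≡ 1ℤ + (+ 3) ^ suc K [mod (+ 3) ^ suc (suc K) ] →
                    ¬ x ≡ 0ℤ [mod + 3 ] → g ^ e ≡ x [mod (+ 3) ^ suc K ] →
                    ∃[ r ] r < 3 × g ^ (e ℕ.+ N ℕ.* r) ≡ x [mod (+ 3) ^ suc (suc K) ]
  lift-^-solution {g} {x} K N {e} g^N≡1+a x≢0 (congruent q g^e≡x+qa) =
    let r , r<3 , q+rx≡0 = c+rx≡0-mod-3-solvable x≢0 q
    in r , r<3 , (begin
      g ^ (e ℕ.+ N ℕ.* r)          ≡⟨ ^-+-* g e N r ⟩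
      g ^ e * (g ^ N) ^ r          ≈⟨ ≡-mod-*-congˡ (g ^ e) (≡-mod-^-cong g^N≡1+a r) ⟩
      g ^ e * (1ℤ + a) ^ r         ≈⟨ ≡-mod-*-congˡ (g ^ e) ([1+a]^r≡1+ra {a = a} ([3p]²≡0-mod-9p p) r) ⟩
      g ^ e * (1ℤ + + r * a)       ≡⟨ cong (_* (1ℤ + + r * a)) g^e≡x+qa ⟩
      (x + q * a) * (1ℤ + + r * a) ≈⟨ [x+qa][1+Ra]≡x-mod-3a {p} {x} {q} {+ r} q+rx≡0 ⟩
      x                            ∎)
    where
    p = (+ 3) ^ K
    a = + 3 * p
    open ≡-mod-Reasoning (+ 3 * a)

  cube-≡-mod : ∀ {p x} → x ≡ 1ℤ + + 3 * p [mod + 3 * (+ 3 * p) ] →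
               x ^ 3 ≡ 1ℤ + + 3 * (+ 3 * p) [mod + 3 * (+ 3 * (+ 3 * p)) ]
  cube-≡-mod {p} (congruent c refl) = congruent (c + p * b * b * (1ℤ + p * b)) (expand p c)
    where
    b = 1ℤ + + 3 * c
    -- x ^ 3 unfolds to x * (x * (x * 1ℤ)), the form the ring solver can read.
    expand : ∀ p c → let x = 1ℤ + + 3 * p + c * (+ 3 * (+ 3 * p)) ; b = 1ℤ + + 3 * c in
             x * (x * (x * 1ℤ)) ≡
             1ℤ + + 3 * (+ 3 * p) + (c + p * b * b * (1ℤ + p * b)) * (+ 3 * (+ 3 * (+ 3 * p)))
    expand p c = solve (p ∷ c ∷ [])

  4^3^k≡1+3^[k+1] : ∀ k → (+ 4) ^ (3 ℕ.^ k) ≡ 1ℤ + (+ 3) ^ suc k [mod (+ 3) ^ suc (suc k) ]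
  4^3^k≡1+3^[k+1] zero    = ≡-mod-refl
  4^3^k≡1+3^[k+1] (suc k) = begin
    (+ 4) ^ (3 ℕ.* 3 ℕ.^ k)  ≡⟨ cong ((+ 4) ^_) (ℕₚ.*-comm 3 (3 ℕ.^ k)) ⟩
    (+ 4) ^ (3 ℕ.^ k ℕ.* 3)  ≡⟨ ^-*-assoc (+ 4) (3 ℕ.^ k) 3 ⟨
    ((+ 4) ^ (3 ℕ.^ k)) ^ 3  ≈⟨ cube-≡-mod (4^3^k≡1+3^[k+1] k) ⟩
    1ℤ + (+ 3) ^ suc (suc k) ∎
    where open ≡-mod-Reasoning ((+ 3) ^ suc (suc (suc k)))

  4^3^k≡1 : ∀ k → (+ 4) ^ (3 ℕ.^ k) ≡ 1ℤ [mod (+ 3) ^ suc k ]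
  4^3^k≡1 k = ≡-mod-trans (≡-mod-weaken (divides (+ 3) refl) (4^3^k≡1+3^[k+1] k))
                          (congruent 1ℤ (cong (_+_ 1ℤ) (sym (*-identityˡ ((+ 3) ^ suc k)))))

  2^[2·3^k]≡1+3^[k+1] : ∀ k → (+ 2) ^ (2 ℕ.* 3 ℕ.^ k) ≡ 1ℤ + (+ 3) ^ suc k [mod (+ 3) ^ suc (suc k) ]
  2^[2·3^k]≡1+3^[k+1] k = subst (λ z → z ≡ 1ℤ + (+ 3) ^ suc k [mod (+ 3) ^ suc (suc k) ])
                                (^-*-assoc (+ 2) 2 (3 ℕ.^ k)) (4^3^k≡1+3^[k+1] k)

  ^-periodic : ∀ {g N M} → g ^ N ≡ 1ℤ [mod M ] → ∀ y n → g ^ (y ℕ.+ N ℕ.* n) ≡ g ^ y [mod M ]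
  ^-periodic {g} {N} {M} g^N≡1 y n = begin
    g ^ (y ℕ.+ N ℕ.* n) ≡⟨ ^-+-* g y N n ⟩
    g ^ y * (g ^ N) ^ n ≈⟨ ≡-mod-*-congˡ (g ^ y) (≡-mod-^-cong g^N≡1 n) ⟩
    g ^ y * 1ℤ ^ n      ≡⟨ cong (_*_ (g ^ y)) (^-zeroˡ n) ⟩
    g ^ y * 1ℤ          ≡⟨ *-identityʳ (g ^ y) ⟩
    g ^ y               ∎
    where open ≡-mod-Reasoning M

  +x≡+y+n*N⇒x≡y+N*n : ∀ {x y n N} → + x ≡ + y + + n * + N → x ≡ y ℕ.+ N ℕ.* n
  +x≡+y+n*N⇒x≡y+N*n {y = y} {n} {N} x≡y+nN =
    +-injective (trans x≡y+nN (cong (_+_ (+ y)) (trans (sym (pos-* n N)) (cong +_ (ℕₚ.*-comm n N)))))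

  ^-≡-mod-exponent : ∀ {g N M x y} → g ^ N ≡ 1ℤ [mod M ] → + x ≡ + y [mod + N ] →
                     g ^ x ≡ g ^ y [mod M ]
  ^-≡-mod-exponent {g} {N} {M} {x} {y} g^N≡1 (congruent (+ n) x≡y+nN) =
    subst (λ z → g ^ z ≡ g ^ y [mod M ]) (sym (+x≡+y+n*N⇒x≡y+N*n {x} {y} {n} {N} x≡y+nN))
          (^-periodic {g} {N} g^N≡1 y n)
  ^-≡-mod-exponent {g} {N} {M} {x} {y} g^N≡1 x≡y@(congruent -[1+ n ] _) =
    ≡-mod-sym (subst (λ z → g ^ z ≡ g ^ x [mod M ]) (sym (+x≡+y+n*N⇒x≡y+N*n {y} {x} {suc n} {N} y≡x+nN))
                     (^-periodic {g} {N} g^N≡1 x (suc n)))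
    where
    -- ≡-mod-sym negates the quotient, here to + suc n.
    y≡x+nN : + y ≡ + x + + suc n * + N
    y≡x+nN = _≡_[mod_].equality (≡-mod-sym x≡y)

  2-generates-units : ∀ k {x} → ¬ x ≡ 0ℤ [mod + 3 ] →
                      ∃[ e ] e < 2 ℕ.* 3 ℕ.^ k × (+ 2) ^ e ≡ x [mod (+ 3) ^ suc k ]
  2-generates-units zero x≢0 with nonzero-residues-mod-3 x≢0
  ... | inj₁ x≡1 = 0 , s≤s z≤n , ≡-mod-sym x≡1
  ... | inj₂ x≡2 = 1 , s≤s (s≤s z≤n) , ≡-mod-sym x≡2
  2-generates-units (suc k) x≢0 =
    let e , e<N , 2^e≡x        = 2-generates-units k x≢0
        r , r<3 , 2^[e+Nr]≡x = lift-^-solution {+ 2} k N {e} (2^[2·3^k]≡1+3^[k+1] k) x≢0 2^e≡x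
    in e ℕ.+ N ℕ.* r , ℕₚ.<-≤-trans (+-*-< e<N r<3) (ℕₚ.≤-reflexive N*3≡) , 2^[e+Nr]≡x
    where
    N = 2 ℕ.* 3 ℕ.^ k
    N*3≡ : N ℕ.* 3 ≡ 2 ℕ.* 3 ℕ.^ suc k
    N*3≡ = trans (ℕₚ.*-assoc 2 (3 ℕ.^ k) 3) (cong (2 ℕ.*_) (ℕₚ.*-comm (3 ℕ.^ k) 3))

  4-generates-≡1-mod-3 : ∀ k {t} → t ≡ 1ℤ [mod + 3 ] → ∃[ j ] (+ 4) ^ j ≡ t [mod (+ 3) ^ suc k ]
  4-generates-≡1-mod-3 zero    t≡1 = 0 , ≡-mod-sym t≡1
  4-generates-≡1-mod-3 (suc k) t≡1 =
    let j , 4^j≡t          = 4-generates-≡1-mod-3 k t≡1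
        r , _ , 4^[j+Nr]≡t = lift-^-solution {+ 4} k (3 ℕ.^ k) {j} (4^3^k≡1+3^[k+1] k)
                                              (≡1⇒≢0-mod-3 t≡1) 4^j≡t
    in j ℕ.+ 3 ℕ.^ k ℕ.* r , 4^[j+Nr]≡t

  4^3i≡1-mod-9 : ∀ {j} → + j ≡ 0ℤ [mod + 3 ] → (+ 4) ^ j ≡ 1ℤ [mod + 9 ]
  4^3i≡1-mod-9 {j} (congruent i j≡3i) = begin
    (+ 4) ^ j                 ≈⟨ [1+a]^r≡1+ra {a = + 3} (congruent 1ℤ refl) j ⟩
    1ℤ + + j * + 3            ≡⟨ cong (λ u → 1ℤ + u * + 3) j≡3i ⟩
    1ℤ + (0ℤ + i * + 3) * + 3 ≈⟨ congruent i (solve (i ∷ [])) ⟩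
    1ℤ                        ∎
    where open ≡-mod-Reasoning (+ 9)

  4^j≡t⇒j≢0-mod-3 : ∀ k {j t} → (+ 4) ^ j ≡ t [mod (+ 3) ^ suc (suc k) ] →
                    ¬ t ≡ 1ℤ [mod + 9 ] → ¬ + j ≡ 0ℤ [mod + 3 ]
  4^j≡t⇒j≢0-mod-3 k 4^j≡t t≢1 j≡0 =
    t≢1 (≡-mod-trans (≡-mod-sym (≡-mod-weaken 9∣3^[k+2] 4^j≡t)) (4^3i≡1-mod-9 j≡0))
    where
    9∣3^[k+2] : + 9 ∣ (+ 3) ^ suc (suc k)
    9∣3^[k+2] = divides ((+ 3) ^ k)
                  (trans (sym (*-assoc (+ 3) (+ 3) ((+ 3) ^ k))) (*-comm (+ 9) ((+ 3) ^ k)))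

  pos-2^2^[e+1] : ∀ e → + (2 ℕ.^ 2 ℕ.^ suc e) ≡ (+ 4) ^ (2 ℕ.^ e)
  pos-2^2^[e+1] e = trans (pos-^ 2 (2 ℕ.* 2 ℕ.^ e)) (sym (^-*-assoc (+ 2) 2 (2 ℕ.^ e)))

  2^2^n≡t-mod-3^[k+2] : ∀ k {t} → t ≡ 1ℤ [mod + 3 ] → ¬ t ≡ 1ℤ [mod + 9 ] →
                        ∃[ n ] n ≤ 2 ℕ.* 3 ℕ.^ k × + (2 ℕ.^ 2 ℕ.^ n) ≡ t [mod + (3 ℕ.^ suc (suc k)) ]
  2^2^n≡t-mod-3^[k+2] k {t} t≡1 t≢1 =
    let j , 4^j≡t      = 4-generates-≡1-mod-3 (suc k) t≡1
        e , e< , 2^e≡j = 2-generates-units k (4^j≡t⇒j≢0-mod-3 k 4^j≡t t≢1)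
        4^2^e≡4^j      = ^-≡-mod-exponent (4^3^k≡1 (suc k))
                           (subst₂ (λ u v → u ≡ + j [mod v ]) (sym (pos-^ 2 e)) (sym (pos-^ 3 (suc k))) 2^e≡j)
    in suc e , e< ,
       subst₂ (λ u v → u ≡ t [mod v ]) (sym (pos-2^2^[e+1] e)) (sym (pos-^ 3 (suc (suc k))))
              (≡-mod-trans 4^2^e≡4^j 4^j≡t)

open IntegerCongruence using (∣⇒≡-mod; ≡-mod⇒∣)
open PowersModPowersOfThree using (2^2^n≡t-mod-3^[k+2])
open import Data.Nat using (ℕ; _≤_; _^_; _∸_; _*_; suc; s≤s; z≤n)
open import Data.Integer using (ℤ; +_; _-_)
open import Data.Integer.Divisibility using (_∣_)
open import Data.Integer.Divisibility.Signed using (∣ᵤ⇒∣; ∣⇒∣ᵤ)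
open import Data.Product using (∃-syntax; _×_; _,_)
open import Function using (_∘_)
open import Relation.Nullary using (¬_)

lemma5 : (m : ℕ) → 2 ≤ m → (t : ℤ) → (+ 3) ∣ (t - + 1) → ¬ ((+ 9) ∣ (t - + 1)) →
    ∃[ n ] ((n ≤ 2 * 3 ^ (m ∸ 2)) × ((+ (3 ^ m)) ∣ ((+ (2 ^ (2 ^ n))) - t)))
lemma5 (suc (suc k)) (s≤s (s≤s z≤n)) t 3∣t-1 9∤t-1 =
  let n , n≤ , 2^2^n≡t = 2^2^n≡t-mod-3^[k+2] k {t} (∣⇒≡-mod (∣ᵤ⇒∣ 3∣t-1))
                                                   (9∤t-1 ∘ ∣⇒∣ᵤ ∘ ≡-mod⇒∣)
  in n , n≤ , ∣⇒∣ᵤ (≡-mod⇒∣ 2^2^n≡t)
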